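{- For every odd integer $t\geq 7$ with $t\neq 11$ there exists a $(4t,4,\{3,5\},1)$-CDF.
   Context: For positive integers $g,t$ and a set $K$ of positive integers, a $(gt,g,K,1)$-CDF (cyclic difference family) is a family $\mathcal{F}$ of subsets (base blocks) of $Z_{gt}$, each of size in $K$, such that the multiset $\bigcup_{B\in\mathcal{F}}\{x-y: x,y\in B, x\neq y\}$ contains each element of $Z_{gt}\setminus\{0,t,2t,\ldots,(g-1)t\}$ exactly once. -}

module Defs where

open import Data.Nat using (ℕ; _+_; _*_; _∸_; _<_; _≤?_; _≟_)
open import Data.Nat.Divisibility using (_∣_)
open import Data.List using (List; []; _∷_; length; filter; concatMap)
open import Data.List.Relation.Unary.All using (All)
open import Data.List.Relation.Unary.Unique.Propositional using (Unique)
open import Data.List.Membership.Propositional using (_∈_)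
open import Data.Product using (_×_)
open import Relation.Binary.PropositionalEquality using (_≡_)
open import Relation.Nullary using (¬_; yes; no)

-- Elements of Z_v are represented by naturals 0,…,v-1.
-- Subtraction in Z_v on such representatives: (x - y) mod v.
subMod : ℕ → ℕ → ℕ → ℕ
subMod v x y with y ≤? x
... | yes _ = x ∸ y
... | no  _ = (v + x) ∸ y

-- All differences x - y (mod v) with x, y ∈ B, x ≠ y (as a list = multiset).
blockDiffs : ℕ → List ℕ → List ℕ
blockDiffs v B = concatMap (λ x → concatMap (λ y → pick x y) B) B
  where
  pick : ℕ → ℕ → List ℕ
  pick x y with x ≟ y
  ... | yes _ = []
  ... | no  _ = subMod v x y ∷ []

familyDiffs : ℕ → List (List ℕ) → List ℕ
familyDiffs v F = concatMap (blockDiffs v) F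

count : ℕ → List ℕ → ℕ
count d xs = length (filter (d ≟_) xs)

IsBaseBlock : ℕ → List ℕ → List ℕ → Set
IsBaseBlock v K B = All (_< v) B × Unique B × (length B ∈ K)

-- (gt, g, K, 1)-CDF: each element of Z_{gt} \ {0, t, ..., (g-1)t}
-- occurs exactly once among the differences, and the elements
-- 0, t, ..., (g-1)t (the d < gt with t ∣ d) do not occur at all.
IsCDF : ℕ → ℕ → List ℕ → List (List ℕ) → Set
IsCDF g t K F =
  All (IsBaseBlock (g * t) K) F ×
  (∀ d → d < g * t →
     (t ∣ d → count d (familyDiffs (g * t) F) ≡ 0) ×
     (¬ (t ∣ d) → count d (familyDiffs (g * t) F) ≡ 1))

module Submission where

-- Write t = 7 + 6m, 9 + 6m or 17 + 6m.  In each case the base blocks have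
-- entries that are linear forms in m: two interleaved families of triangles
-- {0, a + 2i, a + b + k + i} (i < k), whose differences fill whole intervals,
-- and a few single triangles and pentagons.  A family is a (4t, 4, K, 1)-CDF
-- as soon as its differences together with t, 2t, 3t are exactly 1, …, 4t − 1.
-- All differences are again linear forms in m (whether x − y or 4t + x − y is
-- the reduced one is decided coefficientwise), so that this tiling of [1, 4t)
-- is checked by computing on coefficients, once for all m.

open import Defs
open import Data.Nat using (ℕ; _≤_)
open import Data.Nat.Divisibility using (_∣_)
open import Data.List using (List; []; _∷_)
open import Data.Product using (∃)
open import Relation.Binary.PropositionalEquality using (_≢_)
open import Relation.Nullary using (¬_)

open import Data.List using (_++_; [_]; map; concatMap; filter; length)
open import Data.List.Membership.Propositional using (_∈_; find)
open import Data.List.Membership.Propositional.Properties using (∈-∃++)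
open import Data.List.Properties
  using (filter-accept; filter-reject; filter-++; length-++; ++-identityʳ; map-++; map-∘; map-cong; map-cong-local; concatMap-++)
open import Data.List.Relation.Binary.Permutation.Propositional
  using (_↭_; ↭-refl; ↭-trans; ↭-reflexive; prep; module PermutationReasoning)
open import Data.List.Relation.Binary.Permutation.Propositional.Properties
  using (filter-↭; ↭-length; ++⁺; ++⁺ˡ; ++⁺ʳ; map⁺; shift; shifts; ∷↭∷ʳ; ++-commutativeMonoid)
open import Data.List.Relation.Unary.All using (All; []; _∷_; all?)
import Data.List.Relation.Unary.All as All
import Data.List.Relation.Unary.All.Properties as All
open import Data.List.Relation.Unary.AllPairs using (AllPairs; []; _∷_)
import Data.List.Relation.Unary.AllPairs as AllPairs
import Data.List.Relation.Unary.AllPairs.Properties as AllPairs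
open import Data.List.Relation.Unary.Any using (here; there; any?)
open import Data.List.Relation.Unary.Unique.Propositional using (Unique)
open import Data.Maybe using (Maybe; just; nothing; from-just)
import Data.Maybe as Maybe
open import Data.Nat using (zero; suc; _+_; _*_; _∸_; _<_; _≟_; _≤?_; _<?_; z≤n; s≤s; z<s; NonZero)
open import Data.Nat.DivMod using (_%_; _/_; m≡m%n+[m/n]*n; m%n<n)
open import Data.Nat.Divisibility using (divides; _∣0; ∣-trans; ∣m∣n⇒∣m+n; n∣m*n)
open import Data.Nat.Properties
open import Data.Nat.Tactic.RingSolver using (solve-∀)
open import Data.Product using (_,_; _×_; proj₁; proj₂; uncurry)
import Data.Product as Product
open import Data.Sum using (_⊎_; inj₁; inj₂)
open import Relation.Binary.PropositionalEquality hiding ([_])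
open import Relation.Nullary using (Dec; yes; no; contradiction; map′; _×-dec_; _⊎-dec_)
import Algebra.Solver.CommutativeMonoid as CommutativeMonoidSolver
open CommutativeMonoidSolver (++-commutativeMonoid {A = ℕ}) using (solve; _⊜_; _⊕_)

count-here : ∀ d xs → count d (d ∷ xs) ≡ suc (count d xs)
count-here d xs = cong length (filter-accept (d ≟_) {d} {xs} refl)

count-there : ∀ {d x} xs → d ≢ x → count d (x ∷ xs) ≡ count d xs
count-there {d} {x} xs d≢x = cong length (filter-reject (d ≟_) {x} {xs} d≢x)

count-++ : ∀ d xs ys → count d (xs ++ ys) ≡ count d xs + count d ys
count-++ d xs ys = trans (cong length (filter-++ (d ≟_) xs ys)) (length-++ (filter (d ≟_) xs))

count-↭ : ∀ d {xs ys} → xs ↭ ys → count d xs ≡ count d ys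
count-↭ d p = ↭-length (filter-↭ (d ≟_) p)

range : ℕ → ℕ → List ℕ
range a zero    = []
range a (suc l) = a ∷ range (suc a) l

count-range-below : ∀ {d a} l → d < a → count d (range a l) ≡ 0
count-range-below zero    d<a = refl
count-range-below {d} {a} (suc l) d<a =
  trans (count-there (range (suc a) l) (<⇒≢ d<a)) (count-range-below l (m<n⇒m<1+n d<a))

count-range-inside : ∀ {d a} l → a ≤ d → d < a + l → count d (range a l) ≡ 1
count-range-inside {d} {a} zero a≤d d<a+0 = contradiction (subst (d <_) (+-identityʳ a) d<a+0) (≤⇒≯ a≤d)
count-range-inside {d} {a} (suc l) a≤d d<a+1+l with d ≟ a
... | yes refl = trans (count-here d (range (suc d) l)) (cong suc (count-range-below l (n<1+n d)))
... | no d≢a   = trans (count-there (range (suc a) l) d≢a)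
  (count-range-inside l (≤∧≢⇒< a≤d (≢-sym d≢a)) (subst (d <_) (+-suc a l) d<a+1+l))

range-++ : ∀ a k l → range a k ++ range (a + k) l ≡ range a (k + l)
range-++ a zero    l = cong (λ b → range b l) (+-identityʳ a)
range-++ a (suc k) l = cong (a ∷_) (trans (cong (λ b → range (suc a) k ++ range b l) (+-suc a k)) (range-++ (suc a) k l))

range-snoc : ∀ a k → range a (suc k) ≡ range a k ++ [ a + k ]
range-snoc a k = trans (cong (range a) (+-comm 1 k)) (sym (range-++ a k 1))

progression : ℕ → ℕ → List ℕ
progression a zero    = []
progression a (suc k) = a ∷ progression (2 + a) k

progression-interleave : ∀ a k → progression a k ++ progression (suc a) k ↭ range a (k + k)
progression-interleave a zero    = ↭-refl
progression-interleave a (suc k) = prep a (↭-trans (shift (suc a) (progression (2 + a) k) _)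
  (↭-trans (prep (suc a) (progression-interleave (2 + a) k)) (↭-reflexive (cong (range (suc a)) (sym (+-suc k k))))))

mirror-range : ∀ {v} x l y → x + l + y ≡ suc v → map (v ∸_) (range x l) ↭ range y l
mirror-range x zero    y _  = ↭-refl
mirror-range {v} x (suc l) y eq = begin
  (v ∸ x) ∷ map (v ∸_) (range (suc x) l)  ↭⟨ prep (v ∸ x) (mirror-range (suc x) l y (trans (cong (_+ y) (sym (+-suc x l))) eq)) ⟩
  (v ∸ x) ∷ range y l                      ≡⟨ cong (_∷ range y l) v∸x≡y+l ⟩
  (y + l) ∷ range y l                      ↭⟨ ∷↭∷ʳ (y + l) (range y l) ⟩
  range y l ++ [ y + l ]                   ≡⟨ range-snoc y l ⟨
  range y (suc l)                          ∎
  where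
  open PermutationReasoning
  v∸x≡y+l : v ∸ x ≡ y + l
  v∸x≡y+l = trans (cong (_∸ x) (suc-injective (trans (sym eq) (regroup x l y)))) (m+n∸m≡n x (y + l))
    where
    regroup : ∀ x l y → x + suc l + y ≡ suc (x + (y + l))
    regroup = solve-∀

-- A counting criterion for CDFs

count-multiples : ∀ {t} .{{_ : NonZero t}} j xs → count (j * t) (map (_* t) xs) ≡ count j xs
count-multiples j [] = refl
count-multiples {t} j (x ∷ xs) with j ≟ x
... | yes refl = trans (count-here (j * t) _) (trans (cong suc (count-multiples j xs)) (sym (count-here j xs)))
... | no j≢x   = trans (count-there _ (λ eq → j≢x (*-cancelʳ-≡ j x t eq)))
                       (trans (count-multiples j xs) (sym (count-there xs j≢x)))

count-nonMultiple : ∀ {d t} → ¬ t ∣ d → ∀ xs → count d (map (_* t) xs) ≡ 0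
count-nonMultiple t∤d []       = refl
count-nonMultiple t∤d (x ∷ xs) =
  trans (count-there _ (λ eq → t∤d (divides x eq))) (count-nonMultiple t∤d xs)

isCDF-fromDifferences : ∀ {n t K F} L → suc L ≡ suc n * t →
  All (IsBaseBlock (suc n * t) K) F →
  familyDiffs (suc n * t) F ++ map (_* t) (range 1 n) ↭ range 1 L →
  IsCDF (suc n) t K F
isCDF-fromDifferences {n} {zero} L _ blocks _ = blocks , λ d d<0 →
  contradiction (subst (d <_) (*-zeroʳ n) d<0) λ ()
isCDF-fromDifferences {n} {t@(suc _)} {K} {F} L total blocks diffs =
  blocks , λ d d<v → divisible d d<v , indivisible d d<v
  where
  D = familyDiffs (suc n * t) F
  M = map (_* t) (range 1 n)

  split : ∀ d → count d D + count d M ≡ count d (range 1 L)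
  split d = trans (sym (count-++ d D M)) (count-↭ d diffs)

  inside : ∀ {d} → 0 < d → d < suc n * t → count d (range 1 L) ≡ 1
  inside {d} 0<d d<v = count-range-inside L 0<d (subst (d <_) (sym total) d<v)

  divisible : ∀ d → d < suc n * t → t ∣ d → count d D ≡ 0
  divisible d d<v (divides zero refl) = m+n≡0⇒m≡0 (count 0 D) (trans (split 0) (count-range-below L z<s))
  divisible d d<v (divides (suc j) refl) = +-cancelʳ-≡ 1 (count d D) 0 (begin
    count d D + 1             ≡⟨ cong (count d D +_) (trans (count-multiples (suc j) (range 1 n)) (count-range-inside n (s≤s z≤n) j<n)) ⟨
    count d D + count d M     ≡⟨ split d ⟩
    count d (range 1 L)       ≡⟨ inside (≤-trans (s≤s z≤n) (m≤n*m t (suc j))) d<v ⟩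
    1                         ∎)
    where
    open ≡-Reasoning
    j<n : suc j < suc n
    j<n = *-cancelʳ-< t (suc j) (suc n) d<v

  indivisible : ∀ d → d < suc n * t → ¬ t ∣ d → count d D ≡ 1
  indivisible d d<v t∤d = begin
    count d D                 ≡⟨ +-identityʳ (count d D) ⟨
    count d D + 0             ≡⟨ cong (count d D +_) (count-nonMultiple t∤d (range 1 n)) ⟨
    count d D + count d M     ≡⟨ split d ⟩
    count d (range 1 L)       ≡⟨ inside (n≢0⇒n>0 (λ { refl → t∤d (t ∣0) })) d<v ⟩
    1                         ∎
    where open ≡-Reasoning

offDiagonal′ : {A : Set} → List A → List A → List (A × A)
offDiagonal′ before []          = []
offDiagonal′ before (x ∷ after) = map (x ,_) before ++ map (x ,_) after ++ offDiagonal′ (before ++ [ x ]) after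

-- Ordered pairs of entries at distinct positions, in the order in which
-- blockDiffs visits them.
offDiagonal : {A : Set} → List A → List (A × A)
offDiagonal = offDiagonal′ []

offDiagonal′-map : ∀ {A B : Set} (f : A → B) before after →
  offDiagonal′ (map f before) (map f after) ≡ map (Product.map f f) (offDiagonal′ before after)
offDiagonal′-map f before []          = refl
offDiagonal′-map f before (x ∷ after) = begin
  offDiagonal′ (map f before) (map f (x ∷ after))
    ≡⟨ cong₂ _++_ (pairing before) (cong₂ _++_ (pairing after) later) ⟩
  map g (map (x ,_) before) ++ map g (map (x ,_) after) ++ map g (offDiagonal′ (before ++ [ x ]) after)
    ≡⟨ cong (map g (map (x ,_) before) ++_) (map-++ g (map (x ,_) after) _) ⟨
  map g (map (x ,_) before) ++ map g (map (x ,_) after ++ offDiagonal′ (before ++ [ x ]) after)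
    ≡⟨ map-++ g (map (x ,_) before) _ ⟨
  map g (offDiagonal′ before (x ∷ after))
    ∎
  where
  open ≡-Reasoning
  g = Product.map f f
  pairing : ∀ ys → map (f x ,_) (map f ys) ≡ map g (map (x ,_) ys)
  pairing ys = trans (sym (map-∘ ys)) (map-∘ ys)
  later : offDiagonal′ (map f before ++ [ f x ]) (map f after) ≡ map g (offDiagonal′ (before ++ [ x ]) after)
  later = trans (cong (λ b → offDiagonal′ b (map f after)) (sym (map-++ f before [ x ])))
                (offDiagonal′-map f (before ++ [ x ]) after)

blockDiffs-triangle : ∀ v {x y z} → Unique (x ∷ y ∷ z ∷ []) →
  blockDiffs v (x ∷ y ∷ z ∷ []) ≡ map (uncurry (subMod v)) (offDiagonal (x ∷ y ∷ z ∷ []))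
blockDiffs-triangle v {x} {y} {z} ((x≢y ∷ x≢z ∷ []) ∷ (y≢z ∷ []) ∷ [] ∷ [])
  rewrite ≟-diag {x} refl | ≟-diag {y} refl | ≟-diag {z} refl
        | ≢-≟-identity _≟_ x≢y | ≢-≟-identity _≟_ x≢z | ≢-≟-identity _≟_ y≢z
        | ≢-≟-identity _≟_ (≢-sym x≢y) | ≢-≟-identity _≟_ (≢-sym x≢z) | ≢-≟-identity _≟_ (≢-sym y≢z)
  = refl

blockDiffs-pentagon : ∀ v {x y z u w} → Unique (x ∷ y ∷ z ∷ u ∷ w ∷ []) →
  blockDiffs v (x ∷ y ∷ z ∷ u ∷ w ∷ []) ≡ map (uncurry (subMod v)) (offDiagonal (x ∷ y ∷ z ∷ u ∷ w ∷ []))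
blockDiffs-pentagon v {x} {y} {z} {u} {w}
  ((x≢y ∷ x≢z ∷ x≢u ∷ x≢w ∷ []) ∷ (y≢z ∷ y≢u ∷ y≢w ∷ []) ∷ (z≢u ∷ z≢w ∷ []) ∷ (u≢w ∷ []) ∷ [] ∷ [])
  rewrite ≟-diag {x} refl | ≟-diag {y} refl | ≟-diag {z} refl | ≟-diag {u} refl | ≟-diag {w} refl
        | ≢-≟-identity _≟_ x≢y | ≢-≟-identity _≟_ x≢z | ≢-≟-identity _≟_ x≢u | ≢-≟-identity _≟_ x≢w
        | ≢-≟-identity _≟_ y≢z | ≢-≟-identity _≟_ y≢u | ≢-≟-identity _≟_ y≢w
        | ≢-≟-identity _≟_ z≢u | ≢-≟-identity _≟_ z≢w | ≢-≟-identity _≟_ u≢w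
        | ≢-≟-identity _≟_ (≢-sym x≢y) | ≢-≟-identity _≟_ (≢-sym x≢z) | ≢-≟-identity _≟_ (≢-sym x≢u)
        | ≢-≟-identity _≟_ (≢-sym x≢w) | ≢-≟-identity _≟_ (≢-sym y≢z) | ≢-≟-identity _≟_ (≢-sym y≢u)
        | ≢-≟-identity _≟_ (≢-sym y≢w) | ≢-≟-identity _≟_ (≢-sym z≢u) | ≢-≟-identity _≟_ (≢-sym z≢w)
        | ≢-≟-identity _≟_ (≢-sym u≢w)
  = refl

subMod-≥ : ∀ v {x y} → y ≤ x → subMod v x y ≡ x ∸ y
subMod-≥ v {x} {y} y≤x with y ≤? x
... | yes _   = refl
... | no y≰x = contradiction y≤x y≰x

subMod-< : ∀ v {x y} → x < y → subMod v x y ≡ v ∸ (y ∸ x)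
subMod-< v {x} {y} x<y with y ≤? x
... | yes y≤x = contradiction y≤x (<⇒≱ x<y)
... | no _    = begin
  v + x ∸ y                 ≡⟨ cong (v + x ∸_) (m+[n∸m]≡n (<⇒≤ x<y)) ⟨
  v + x ∸ (x + (y ∸ x))     ≡⟨ cong (_∸ (x + (y ∸ x))) (+-comm v x) ⟩
  x + v ∸ (x + (y ∸ x))     ≡⟨ [m+n]∸[m+o]≡n∸o x v (y ∸ x) ⟩
  v ∸ (y ∸ x)               ∎
  where open ≡-Reasoning

-- Families of triangles

symmetrise : ℕ → List ℕ → List ℕ
symmetrise v P = P ++ map (v ∸_) P

symmetrise⁺ : ∀ v {P Q} → P ↭ Q → symmetrise v P ↭ symmetrise v Q
symmetrise⁺ v p = ++⁺ p (map⁺ (v ∸_) p)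

symmetrise-++ : ∀ v P Q → symmetrise v P ++ symmetrise v Q ↭ symmetrise v (P ++ Q)
symmetrise-++ v P Q = ↭-trans (interchange P (map (v ∸_) P) Q (map (v ∸_) Q))
  (↭-reflexive (cong ((P ++ Q) ++_) (sym (map-++ (v ∸_) P Q))))
  where
  interchange : ∀ (A B C D : List ℕ) → (A ++ B) ++ (C ++ D) ↭ (A ++ C) ++ (B ++ D)
  interchange = solve 4 (λ A B C D → (A ⊕ B) ⊕ (C ⊕ D) ⊜ (A ⊕ C) ⊕ (B ⊕ D)) ↭-refl

triangle-subMods : ∀ v {a c} → 0 < a → a < c →
  map (uncurry (subMod v)) (offDiagonal (0 ∷ a ∷ c ∷ [])) ≡ v ∸ a ∷ v ∸ c ∷ a ∷ v ∸ (c ∸ a) ∷ c ∷ c ∸ a ∷ []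
triangle-subMods v {a} {c} 0<a a<c
  rewrite subMod-< v 0<a | subMod-< v (<-trans 0<a a<c) | subMod-≥ v {a} z≤n
        | subMod-< v a<c | subMod-≥ v {c} z≤n | subMod-≥ v (<⇒≤ a<c) = refl

triangle-diffs : ∀ v {a c} → 0 < a → a < c → blockDiffs v (0 ∷ a ∷ c ∷ []) ↭ symmetrise v (a ∷ c ∸ a ∷ c ∷ [])
triangle-diffs v {a} {c} 0<a a<c = begin
  blockDiffs v (0 ∷ a ∷ c ∷ [])
    ≡⟨ blockDiffs-triangle v (AllPairs.map <⇒≢ ((0<a ∷ <-trans 0<a a<c ∷ []) ∷ (a<c ∷ []) ∷ [] ∷ [])) ⟩
  map (uncurry (subMod v)) (offDiagonal (0 ∷ a ∷ c ∷ []))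
    ≡⟨ triangle-subMods v 0<a a<c ⟩
  v ∸ a ∷ v ∸ c ∷ a ∷ v ∸ (c ∸ a) ∷ c ∷ c ∸ a ∷ []
    ↭⟨ solve 6 (λ A′ C′ A B′ C B → A′ ⊕ C′ ⊕ A ⊕ B′ ⊕ C ⊕ B ⊜ (A ⊕ B ⊕ C) ⊕ (A′ ⊕ B′ ⊕ C′)) ↭-refl
         [ v ∸ a ] [ v ∸ c ] [ a ] [ v ∸ (c ∸ a) ] [ c ] [ c ∸ a ] ⟩
  symmetrise v (a ∷ c ∸ a ∷ c ∷ [])
    ∎
  where open PermutationReasoning

m<m+n+1+o : ∀ m n o → m < m + n + suc o
m<m+n+1+o m n o = <-≤-trans (m<m+n m z<s) (+-monoˡ-≤ (suc o) (m≤m+n m n))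

-- Block i < k is {0, a + 2i, a + b + k + i}; its differences a + 2i,
-- b + k − i and a + b + k + i run through a progression and two intervals.
triangles : ℕ → ℕ → ℕ → List (List ℕ)
triangles a b zero    = []
triangles a b (suc k) = (0 ∷ a ∷ a + b + suc k ∷ []) ∷ triangles (2 + a) b k

triangles-diffs : ∀ v {a} b k → 0 < a →
  familyDiffs v (triangles a b k) ↭ symmetrise v (progression a k ++ range (suc b) k ++ range (a + b + k) k)
triangles-diffs v b zero    0<a = ↭-refl
triangles-diffs v {a} b (suc k) 0<a = begin
  blockDiffs v (0 ∷ a ∷ c ∷ []) ++ familyDiffs v (triangles (2 + a) b k)
    ↭⟨ ++⁺ (triangle-diffs v 0<a a<c) (triangles-diffs v b k (<-trans 0<a (m<n+m a z<s))) ⟩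
  symmetrise v (a ∷ c ∸ a ∷ c ∷ []) ++ symmetrise v (P ++ B ++ C)
    ↭⟨ symmetrise-++ v (a ∷ c ∸ a ∷ c ∷ []) (P ++ B ++ C) ⟩
  symmetrise v (a ∷ c ∸ a ∷ c ∷ P ++ B ++ C)
    ↭⟨ symmetrise⁺ v (solve 6 (λ A B′ C′ P B C → A ⊕ B′ ⊕ C′ ⊕ P ⊕ B ⊕ C ⊜ (A ⊕ P) ⊕ (B ⊕ B′) ⊕ (C′ ⊕ C)) ↭-refl
                        [ a ] [ c ∸ a ] [ c ] P B C) ⟩
  symmetrise v ((a ∷ P) ++ (B ++ [ c ∸ a ]) ++ (c ∷ C))
    ≡⟨ cong₂ (λ x y → symmetrise v ((a ∷ P) ++ x ++ y))
             (trans (cong (λ x → B ++ [ x ]) c∸a≡) (sym (range-snoc (suc b) k)))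
             (cong (λ x → c ∷ range (suc x) k) (sym (+-suc (a + b) k))) ⟩
  symmetrise v (progression a (suc k) ++ range (suc b) (suc k) ++ range c (suc k))
    ∎
  where
  open PermutationReasoning
  c = a + b + suc k
  P = progression (2 + a) k
  B = range (suc b) k
  C = range (2 + a + b + k) k
  a<c : a < c
  a<c = m<m+n+1+o a b k
  c∸a≡ : c ∸ a ≡ suc b + k
  c∸a≡ = trans (cong (_∸ a) (+-assoc a b (suc k))) (trans (m+n∸m≡n a (b + suc k)) (+-suc b k))

triangles-isBaseBlock : ∀ {v a} b k → 0 < a → a + b + k + k ≤ v → All (IsBaseBlock v (3 ∷ 5 ∷ [])) (triangles a b k)
triangles-isBaseBlock b zero    0<a _     = []
triangles-isBaseBlock {v} {a} b (suc k) 0<a c+k<v =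
  ((<-trans 0<a a<v ∷ a<v ∷ c<v ∷ []) , AllPairs.map <⇒≢ ((0<a ∷ <-trans 0<a a<c ∷ []) ∷ (a<c ∷ []) ∷ [] ∷ []) , here refl)
  ∷ triangles-isBaseBlock b k (<-trans 0<a (m<n+m a z<s)) (subst (_≤ v) (regroup a b k) c+k<v)
  where
  c = a + b + suc k
  a<c = m<m+n+1+o a b k
  c<v : c < v
  c<v = <-≤-trans (m<m+n c z<s) c+k<v
  a<v = <-trans a<c c<v
  regroup : ∀ a b k → a + b + suc k + suc k ≡ 2 + a + b + k + k
  regroup = solve-∀

twinTriangles-diffs : ∀ v {a} b b′ k → 0 < a →
  familyDiffs v (triangles a b k ++ triangles (suc a) b′ k) ↭
  symmetrise v (range a (k + k) ++ range (suc b) k ++ range (a + b + k) k ++ range (suc b′) k ++ range (suc a + b′ + k) k)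
twinTriangles-diffs v {a} b b′ k 0<a = begin
  familyDiffs v (triangles a b k ++ triangles (suc a) b′ k)
    ≡⟨ concatMap-++ (blockDiffs v) (triangles a b k) (triangles (suc a) b′ k) ⟩
  familyDiffs v (triangles a b k) ++ familyDiffs v (triangles (suc a) b′ k)
    ↭⟨ ++⁺ (triangles-diffs v b k 0<a) (triangles-diffs v b′ k z<s) ⟩
  symmetrise v (P ++ B ++ C) ++ symmetrise v (P′ ++ B′ ++ C′)
    ↭⟨ symmetrise-++ v (P ++ B ++ C) (P′ ++ B′ ++ C′) ⟩
  symmetrise v ((P ++ B ++ C) ++ P′ ++ B′ ++ C′)
    ↭⟨ symmetrise⁺ v (solve 6 (λ P B C P′ B′ C′ → (P ⊕ B ⊕ C) ⊕ P′ ⊕ B′ ⊕ C′ ⊜ (P ⊕ P′) ⊕ B ⊕ C ⊕ B′ ⊕ C′) ↭-refl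
                        P B C P′ B′ C′) ⟩
  symmetrise v ((P ++ P′) ++ B ++ C ++ B′ ++ C′)
    ↭⟨ symmetrise⁺ v (++⁺ʳ (B ++ C ++ B′ ++ C′) (progression-interleave a k)) ⟩
  symmetrise v (range a (k + k) ++ B ++ C ++ B′ ++ C′)
    ∎
  where
  open PermutationReasoning
  P = progression a k
  B = range (suc b) k
  C = range (a + b + k) k
  P′ = progression (suc a) k
  B′ = range (suc b′) k
  C′ = range (suc a + b′ + k) k

-- Linear forms c + k·m in a parameter m, and tilings by intervals

data Lin : Set where
  lin : ℕ → ℕ → Lin

⟦_⟧ : Lin → ℕ → ℕ
⟦ lin c k ⟧ m = c + k * m

infixl 6 _+ₗ_ _∸ₗ_
infixl 7 _·ₗ_
infix 4 _≤ₗ_ _<ₗ_ _≤ₗ?_ _<ₗ?_ _≟ₗ_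

_+ₗ_ : Lin → Lin → Lin
lin c k +ₗ lin c′ k′ = lin (c + c′) (k + k′)

_∸ₗ_ : Lin → Lin → Lin
lin c k ∸ₗ lin c′ k′ = lin (c ∸ c′) (k ∸ k′)

_·ₗ_ : ℕ → Lin → Lin
j ·ₗ lin c k = lin (j * c) (j * k)

-- Comparison is coefficientwise, hence valid for every m at once.
data _≤ₗ_ : Lin → Lin → Set where
  coeffs≤ : ∀ {c k c′ k′} → c ≤ c′ → k ≤ k′ → lin c k ≤ₗ lin c′ k′

data _<ₗ_ : Lin → Lin → Set where
  coeffs< : ∀ {c k c′ k′} → c < c′ → k ≤ k′ → lin c k <ₗ lin c′ k′

_≤ₗ?_ : ∀ x y → Dec (x ≤ₗ y)
lin c k ≤ₗ? lin c′ k′ = map′ (uncurry coeffs≤) (λ { (coeffs≤ p q) → p , q }) (c ≤? c′ ×-dec k ≤? k′)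

_<ₗ?_ : ∀ x y → Dec (x <ₗ y)
lin c k <ₗ? lin c′ k′ = map′ (uncurry coeffs<) (λ { (coeffs< p q) → p , q }) (c <? c′ ×-dec k ≤? k′)

_≟ₗ_ : (x y : Lin) → Dec (x ≡ y)
lin c k ≟ₗ lin c′ k′ with c ≟ c′ | k ≟ k′
... | yes refl | yes refl = yes refl
... | no c≢c′  | _        = no λ { refl → c≢c′ refl }
... | _        | no k≢k′  = no λ { refl → k≢k′ refl }

<ₗ⇒≤ₗ : ∀ {x y} → x <ₗ y → x ≤ₗ y
<ₗ⇒≤ₗ (coeffs< c<c′ k≤k′) = coeffs≤ (<⇒≤ c<c′) k≤k′

⟦+ₗ⟧ : ∀ x y m → ⟦ x +ₗ y ⟧ m ≡ ⟦ x ⟧ m + ⟦ y ⟧ m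
⟦+ₗ⟧ (lin c k) (lin c′ k′) m = regroup c k c′ k′ m
  where
  regroup : ∀ c k c′ k′ m → c + c′ + (k + k′) * m ≡ c + k * m + (c′ + k′ * m)
  regroup = solve-∀

⟦·ₗ⟧ : ∀ j x m → ⟦ j ·ₗ x ⟧ m ≡ j * ⟦ x ⟧ m
⟦·ₗ⟧ j (lin c k) m = distribute j c k m
  where
  distribute : ∀ j c k m → j * c + j * k * m ≡ j * (c + k * m)
  distribute = solve-∀

⟦⟧-mono-≤ : ∀ {x y} m → x ≤ₗ y → ⟦ x ⟧ m ≤ ⟦ y ⟧ m
⟦⟧-mono-≤ m (coeffs≤ c≤c′ k≤k′) = +-mono-≤ c≤c′ (*-monoˡ-≤ m k≤k′)

⟦⟧-mono-< : ∀ {x y} m → x <ₗ y → ⟦ x ⟧ m < ⟦ y ⟧ m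
⟦⟧-mono-< m (coeffs< c<c′ k≤k′) = +-mono-<-≤ c<c′ (*-monoˡ-≤ m k≤k′)

+ₗ-∸ₗ : ∀ {x y} → y ≤ₗ x → y +ₗ (x ∸ₗ y) ≡ x
+ₗ-∸ₗ (coeffs≤ c′≤c k′≤k) = cong₂ lin (m+[n∸m]≡n c′≤c) (m+[n∸m]≡n k′≤k)

⟦∸ₗ⟧ : ∀ {x y} m → y ≤ₗ x → ⟦ x ∸ₗ y ⟧ m ≡ ⟦ x ⟧ m ∸ ⟦ y ⟧ m
⟦∸ₗ⟧ {x} {y} m y≤x = begin
  ⟦ x ∸ₗ y ⟧ m                          ≡⟨ m+n∸m≡n (⟦ y ⟧ m) _ ⟨
  ⟦ y ⟧ m + ⟦ x ∸ₗ y ⟧ m ∸ ⟦ y ⟧ m      ≡⟨ cong (_∸ ⟦ y ⟧ m) (⟦+ₗ⟧ y (x ∸ₗ y) m) ⟨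
  ⟦ y +ₗ (x ∸ₗ y) ⟧ m ∸ ⟦ y ⟧ m         ≡⟨ cong (λ z → ⟦ z ⟧ m ∸ ⟦ y ⟧ m) (+ₗ-∸ₗ y≤x) ⟩
  ⟦ x ⟧ m ∸ ⟦ y ⟧ m                     ∎
  where open ≡-Reasoning

Interval : Set
Interval = Lin × Lin

⟦_⟧ᵢ : Interval → ℕ → List ℕ
⟦ a , l ⟧ᵢ m = range (⟦ a ⟧ m) (⟦ l ⟧ m)

⟦_⟧ᵢₛ : List Interval → ℕ → List ℕ
⟦ is ⟧ᵢₛ m = concatMap (λ i → ⟦ i ⟧ᵢ m) is

point : Lin → Interval
point x = x , lin 1 0

⟦points⟧ : ∀ xs m → ⟦ map point xs ⟧ᵢₛ m ≡ map (λ x → ⟦ x ⟧ m) xs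
⟦points⟧ []       m = refl
⟦points⟧ (x ∷ xs) m = cong (⟦ x ⟧ m ∷_) (⟦points⟧ xs m)

mirror : Lin → Interval → Interval
mirror v (x , l) = (lin 1 0 +ₗ v) ∸ₗ (x +ₗ l) , l

MirrorOK : Lin → Interval → Set
MirrorOK v (x , l) = x +ₗ l ≤ₗ lin 1 0 +ₗ v

mirror-sound : ∀ v i m → MirrorOK v i → map (⟦ v ⟧ m ∸_) (⟦ i ⟧ᵢ m) ↭ ⟦ mirror v i ⟧ᵢ m
mirror-sound v (x , l) m ok = mirror-range (⟦ x ⟧ m) (⟦ l ⟧ m) _ (begin
  ⟦ x ⟧ m + ⟦ l ⟧ m + ⟦ y ⟧ m     ≡⟨ cong (_+ ⟦ y ⟧ m) (⟦+ₗ⟧ x l m) ⟨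
  ⟦ x +ₗ l ⟧ m + ⟦ y ⟧ m         ≡⟨ ⟦+ₗ⟧ (x +ₗ l) y m ⟨
  ⟦ x +ₗ l +ₗ y ⟧ m              ≡⟨ cong (λ z → ⟦ z ⟧ m) (+ₗ-∸ₗ ok) ⟩
  ⟦ lin 1 0 +ₗ v ⟧ m             ≡⟨ ⟦+ₗ⟧ (lin 1 0) v m ⟩
  suc (⟦ v ⟧ m)                  ∎)
  where
  open ≡-Reasoning
  y = proj₁ (mirror v (x , l))

mirrors-sound : ∀ v is m → All (MirrorOK v) is → map (⟦ v ⟧ m ∸_) (⟦ is ⟧ᵢₛ m) ↭ ⟦ map (mirror v) is ⟧ᵢₛ m
mirrors-sound v []       m []         = ↭-refl
mirrors-sound v (i ∷ is) m (ok ∷ oks) = ↭-trans (↭-reflexive (map-++ (⟦ v ⟧ m ∸_) (⟦ i ⟧ᵢ m) (⟦ is ⟧ᵢₛ m)))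
  (++⁺ (mirror-sound v i m ok) (mirrors-sound v is m oks))

data Tiling : Lin → List Interval → Lin → Set where
  done : ∀ {a} → Tiling a [] a
  next : ∀ {a l b is} js ks → is ≡ js ++ (a , l) ∷ ks → Tiling (a +ₗ l) (js ++ ks) b → Tiling a is b

tiling-sound : ∀ {a is b} → Tiling a is b → ∀ m →
  ∃ λ L → ⟦ a ⟧ m + L ≡ ⟦ b ⟧ m × ⟦ is ⟧ᵢₛ m ↭ range (⟦ a ⟧ m) L
tiling-sound {a} done m = 0 , +-identityʳ (⟦ a ⟧ m) , ↭-refl
tiling-sound {a} (next {l = l} {b} js ks refl tiling) m with tiling-sound tiling m
... | L , end , tiles = ⟦ l ⟧ m + L , sum , (begin
  ⟦ js ++ (a , l) ∷ ks ⟧ᵢₛ m               ≡⟨ concatMap-++ (λ i → ⟦ i ⟧ᵢ m) js ((a , l) ∷ ks) ⟩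
  ⟦ js ⟧ᵢₛ m ++ R ++ ⟦ ks ⟧ᵢₛ m            ↭⟨ shifts (⟦ js ⟧ᵢₛ m) R ⟩
  R ++ ⟦ js ⟧ᵢₛ m ++ ⟦ ks ⟧ᵢₛ m            ≡⟨ cong (R ++_) (concatMap-++ (λ i → ⟦ i ⟧ᵢ m) js ks) ⟨
  R ++ ⟦ js ++ ks ⟧ᵢₛ m                    ↭⟨ ++⁺ˡ R tiles ⟩
  R ++ range (⟦ a +ₗ l ⟧ m) L              ≡⟨ cong (λ x → R ++ range x L) (⟦+ₗ⟧ a l m) ⟩
  R ++ range (⟦ a ⟧ m + ⟦ l ⟧ m) L         ≡⟨ range-++ (⟦ a ⟧ m) (⟦ l ⟧ m) L ⟩
  range (⟦ a ⟧ m) (⟦ l ⟧ m + L)            ∎)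
  where
  open PermutationReasoning
  R = ⟦ a , l ⟧ᵢ m
  sum : ⟦ a ⟧ m + (⟦ l ⟧ m + L) ≡ ⟦ b ⟧ m
  sum = trans (sym (+-assoc (⟦ a ⟧ m) _ L)) (trans (cong (_+ L) (sym (⟦+ₗ⟧ a l m))) end)

tiling? : ℕ → (a b : Lin) (is : List Interval) → Maybe (Tiling a is b)
tiling? _       a b [] with a ≟ₗ b
... | yes refl = just done
... | no _     = nothing
tiling? zero    a b (_ ∷ _) = nothing
tiling? (suc n) a b is@(_ ∷ _) with any? (λ i → a ≟ₗ proj₁ i) is
... | no _    = nothing
... | yes hit with find hit
...   | (_ , l) , mem , refl with ∈-∃++ mem
...     | js , ks , eq = Maybe.map (next js ks eq) (tiling? n (a +ₗ l) b (js ++ ks))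

subModₗ : Lin → Lin → Lin → Lin
subModₗ v x y with y ≤ₗ? x
... | yes _ = x ∸ₗ y
... | no _  = v ∸ₗ (y ∸ₗ x)

SubModOK : Lin → Lin → Lin → Set
SubModOK v x y = y ≤ₗ x ⊎ (x <ₗ y × y ∸ₗ x ≤ₗ v)

subModOK? : ∀ v x y → Dec (SubModOK v x y)
subModOK? v x y = y ≤ₗ? x ⊎-dec (x <ₗ? y ×-dec y ∸ₗ x ≤ₗ? v)

subModₗ-sound : ∀ v x y m → SubModOK v x y → subMod (⟦ v ⟧ m) (⟦ x ⟧ m) (⟦ y ⟧ m) ≡ ⟦ subModₗ v x y ⟧ m
subModₗ-sound v x y m ok with y ≤ₗ? x | ok
... | yes y≤x | _                    = trans (subMod-≥ _ (⟦⟧-mono-≤ m y≤x)) (sym (⟦∸ₗ⟧ m y≤x))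
... | no y≰x  | inj₁ y≤x             = contradiction y≤x y≰x
... | no _    | inj₂ (x<y , y∸x≤v)  = trans (subMod-< _ (⟦⟧-mono-< m x<y))
  (sym (trans (⟦∸ₗ⟧ m y∸x≤v) (cong (⟦ v ⟧ m ∸_) (⟦∸ₗ⟧ m (<ₗ⇒≤ₗ x<y)))))

data Block : Set where
  triangle : (x y z : Lin) → Block
  pentagon : (x y z u w : Lin) → Block

vertices : Block → List Lin
vertices (triangle x y z)     = x ∷ y ∷ z ∷ []
vertices (pentagon x y z u w) = x ∷ y ∷ z ∷ u ∷ w ∷ []

⟦_⟧ᵦ : Block → ℕ → List ℕ
⟦ B ⟧ᵦ m = map (λ x → ⟦ x ⟧ m) (vertices B)

blockDiffs-offDiagonal : ∀ v B m → Unique (⟦ B ⟧ᵦ m) →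
  blockDiffs v (⟦ B ⟧ᵦ m) ≡ map (uncurry (subMod v)) (offDiagonal (⟦ B ⟧ᵦ m))
blockDiffs-offDiagonal v (triangle _ _ _)     m = blockDiffs-triangle v
blockDiffs-offDiagonal v (pentagon _ _ _ _ _) m = blockDiffs-pentagon v

block-size : ∀ B m → length (⟦ B ⟧ᵦ m) ∈ 3 ∷ 5 ∷ []
block-size (triangle _ _ _)     m = here refl
block-size (pentagon _ _ _ _ _) m = there (here refl)

ValidBlock : Lin → Block → Set
ValidBlock v B = AllPairs _<ₗ_ (vertices B) × All (_<ₗ v) (vertices B) × All (uncurry (SubModOK v)) (offDiagonal (vertices B))

validBlock? : ∀ v B → Dec (ValidBlock v B)
validBlock? v B = AllPairs.allPairs? _<ₗ?_ (vertices B) ×-dec all? (_<ₗ? v) (vertices B)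
  ×-dec all? (uncurry (subModOK? v)) (offDiagonal (vertices B))

blockPieces : Lin → Block → List Interval
blockPieces v B = map point (map (uncurry (subModₗ v)) (offDiagonal (vertices B)))

block-isBaseBlock : ∀ v B m → ValidBlock v B → IsBaseBlock (⟦ v ⟧ m) (3 ∷ 5 ∷ []) (⟦ B ⟧ᵦ m)
block-isBaseBlock v B m (increasing , bounded , _) =
  All.map⁺ (All.map (⟦⟧-mono-< m) bounded) ,
  AllPairs.map⁺ (AllPairs.map (λ x<y → <⇒≢ (⟦⟧-mono-< m x<y)) increasing) ,
  block-size B m

blockDiffs-pieces : ∀ v B m → ValidBlock v B → blockDiffs (⟦ v ⟧ m) (⟦ B ⟧ᵦ m) ≡ ⟦ blockPieces v B ⟧ᵢₛ m
blockDiffs-pieces v B m valid@(_ , _ , pairsOK) = begin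
  blockDiffs V (⟦ B ⟧ᵦ m)
    ≡⟨ blockDiffs-offDiagonal V B m (proj₁ (proj₂ (block-isBaseBlock v B m valid))) ⟩
  map (uncurry (subMod V)) (offDiagonal (⟦ B ⟧ᵦ m))
    ≡⟨ cong (map (uncurry (subMod V))) (offDiagonal′-map at [] (vertices B)) ⟩
  map (uncurry (subMod V)) (map (Product.map at at) (offDiagonal (vertices B)))
    ≡⟨ map-∘ (offDiagonal (vertices B)) ⟨
  map (λ (x , y) → subMod V (⟦ x ⟧ m) (⟦ y ⟧ m)) (offDiagonal (vertices B))
    ≡⟨ map-cong-local (All.map (λ {(x , y)} → subModₗ-sound v x y m) pairsOK) ⟩
  map (λ (x , y) → ⟦ subModₗ v x y ⟧ m) (offDiagonal (vertices B))
    ≡⟨ map-∘ (offDiagonal (vertices B)) ⟩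
  map at (map (uncurry (subModₗ v)) (offDiagonal (vertices B)))
    ≡⟨ ⟦points⟧ (map (uncurry (subModₗ v)) (offDiagonal (vertices B))) m ⟨
  ⟦ blockPieces v B ⟧ᵢₛ m
    ∎
  where
  open ≡-Reasoning
  V = ⟦ v ⟧ m
  at : Lin → ℕ
  at x = ⟦ x ⟧ m

data Shape : Set where
  block         : Block → Shape
  twinTriangles : (a b b′ k : Lin) → Shape

realise : Shape → ℕ → List (List ℕ)
realise (block B)                m = ⟦ B ⟧ᵦ m ∷ []
realise (twinTriangles a b b′ k) m = triangles (⟦ a ⟧ m) (⟦ b ⟧ m) (⟦ k ⟧ m) ++ triangles (suc (⟦ a ⟧ m)) (⟦ b′ ⟧ m) (⟦ k ⟧ m)

twinHalfDiffs : (a b b′ k : Lin) → List Interval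
twinHalfDiffs a b b′ k =
  (a , k +ₗ k) ∷ (lin 1 0 +ₗ b , k) ∷ (a +ₗ b +ₗ k , k) ∷ (lin 1 0 +ₗ b′ , k) ∷ (lin 1 0 +ₗ a +ₗ b′ +ₗ k , k) ∷ []

pieces : Lin → Shape → List Interval
pieces v (block B)                = blockPieces v B
pieces v (twinTriangles a b b′ k) = twinHalfDiffs a b b′ k ++ map (mirror v) (twinHalfDiffs a b b′ k)

Valid : Lin → Shape → Set
Valid v (block B)                = ValidBlock v B
Valid v (twinTriangles a b b′ k) =
  lin 0 0 <ₗ a × a +ₗ b +ₗ k +ₗ k ≤ₗ v × lin 1 0 +ₗ a +ₗ b′ +ₗ k +ₗ k ≤ₗ v × All (MirrorOK v) (twinHalfDiffs a b b′ k)

valid? : ∀ v s → Dec (Valid v s)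
valid? v (block B)                = validBlock? v B
valid? v (twinTriangles a b b′ k) = lin 0 0 <ₗ? a ×-dec a +ₗ b +ₗ k +ₗ k ≤ₗ? v
  ×-dec lin 1 0 +ₗ a +ₗ b′ +ₗ k +ₗ k ≤ₗ? v ×-dec all? (λ (x , l) → x +ₗ l ≤ₗ? lin 1 0 +ₗ v) (twinHalfDiffs a b b′ k)

⟦+ₗ⟧₃ : ∀ x y z m → ⟦ x +ₗ y +ₗ z ⟧ m ≡ ⟦ x ⟧ m + ⟦ y ⟧ m + ⟦ z ⟧ m
⟦+ₗ⟧₃ x y z m = trans (⟦+ₗ⟧ (x +ₗ y) z m) (cong (_+ ⟦ z ⟧ m) (⟦+ₗ⟧ x y m))

⟦+ₗ⟧₄ : ∀ x y z w m → ⟦ x +ₗ y +ₗ z +ₗ w ⟧ m ≡ ⟦ x ⟧ m + ⟦ y ⟧ m + ⟦ z ⟧ m + ⟦ w ⟧ m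
⟦+ₗ⟧₄ x y z w m = trans (⟦+ₗ⟧ (x +ₗ y +ₗ z) w m) (cong (_+ ⟦ w ⟧ m) (⟦+ₗ⟧₃ x y z m))

⟦twinHalfDiffs⟧ : ∀ a b b′ k m → let A = ⟦ a ⟧ m; B = ⟦ b ⟧ m; B′ = ⟦ b′ ⟧ m; K = ⟦ k ⟧ m in
  ⟦ twinHalfDiffs a b b′ k ⟧ᵢₛ m ≡
  range A (K + K) ++ range (suc B) K ++ range (A + B + K) K ++ range (suc B′) K ++ range (suc A + B′ + K) K
⟦twinHalfDiffs⟧ a b b′ k m
  rewrite ⟦+ₗ⟧ k k m | ⟦+ₗ⟧ (lin 1 0) b m | ⟦+ₗ⟧₃ a b k m | ⟦+ₗ⟧ (lin 1 0) b′ m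
        | ⟦+ₗ⟧₄ (lin 1 0) a b′ k m | ++-identityʳ (range (suc (⟦ a ⟧ m) + ⟦ b′ ⟧ m + ⟦ k ⟧ m) (⟦ k ⟧ m))
  = refl

realise-isBaseBlock : ∀ v s m → Valid v s → All (IsBaseBlock (⟦ v ⟧ m) (3 ∷ 5 ∷ [])) (realise s m)
realise-isBaseBlock v (block B) m valid = block-isBaseBlock v B m valid ∷ []
realise-isBaseBlock v (twinTriangles a b b′ k) m (0<a , bound , bound′ , _) = All.++⁺
  (triangles-isBaseBlock (⟦ b ⟧ m) (⟦ k ⟧ m) (⟦⟧-mono-< m 0<a) (subst (_≤ ⟦ v ⟧ m) (⟦+ₗ⟧₄ a b k k m) (⟦⟧-mono-≤ m bound)))
  (triangles-isBaseBlock (⟦ b′ ⟧ m) (⟦ k ⟧ m) z<s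
    (subst (_≤ ⟦ v ⟧ m) (trans (⟦+ₗ⟧ (lin 1 0 +ₗ a +ₗ b′ +ₗ k) k m) (cong (_+ ⟦ k ⟧ m) (⟦+ₗ⟧₄ (lin 1 0) a b′ k m))) (⟦⟧-mono-≤ m bound′)))

realise-diffs : ∀ v s m → Valid v s → familyDiffs (⟦ v ⟧ m) (realise s m) ↭ ⟦ pieces v s ⟧ᵢₛ m
realise-diffs v (block B) m valid = ↭-reflexive (trans (++-identityʳ _) (blockDiffs-pieces v B m valid))
realise-diffs v (twinTriangles a b b′ k) m (0<a , _ , _ , mirrorsOK) = begin
  familyDiffs V (realise (twinTriangles a b b′ k) m)
    ↭⟨ twinTriangles-diffs V (⟦ b ⟧ m) (⟦ b′ ⟧ m) (⟦ k ⟧ m) (⟦⟧-mono-< m 0<a) ⟩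
  symmetrise V (range A (K + K) ++ range (suc B) K ++ range (A + B + K) K ++ range (suc B′) K ++ range (suc A + B′ + K) K)
    ≡⟨ cong (symmetrise V) (⟦twinHalfDiffs⟧ a b b′ k m) ⟨
  H ++ map (V ∸_) H
    ↭⟨ ++⁺ˡ H (mirrors-sound v (twinHalfDiffs a b b′ k) m mirrorsOK) ⟩
  H ++ ⟦ map (mirror v) (twinHalfDiffs a b b′ k) ⟧ᵢₛ m
    ≡⟨ concatMap-++ (λ i → ⟦ i ⟧ᵢ m) (twinHalfDiffs a b b′ k) (map (mirror v) (twinHalfDiffs a b b′ k)) ⟨
  ⟦ pieces v (twinTriangles a b b′ k) ⟧ᵢₛ m
    ∎
  where
  open PermutationReasoning
  V = ⟦ v ⟧ m
  A = ⟦ a ⟧ m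
  B = ⟦ b ⟧ m
  B′ = ⟦ b′ ⟧ m
  K = ⟦ k ⟧ m
  H = ⟦ twinHalfDiffs a b b′ k ⟧ᵢₛ m

realiseDesign : List Shape → ℕ → List (List ℕ)
realiseDesign D m = concatMap (λ s → realise s m) D

multiplesOf : Lin → List Interval
multiplesOf t = map point (map (_·ₗ t) (range 1 3))

designPieces : Lin → List Shape → List Interval
designPieces t D = concatMap (pieces (4 ·ₗ t)) D ++ multiplesOf t

Certificate : Lin → List Shape → Set
Certificate t D = All (Valid (4 ·ₗ t)) D × Tiling (lin 1 0) (designPieces t D) (4 ·ₗ t)

certify : ∀ t D → Maybe (Certificate t D)
certify t D with all? (valid? (4 ·ₗ t)) D
... | no _      = nothing
... | yes valid = Maybe.map (valid ,_) (tiling? (length (designPieces t D)) (lin 1 0) (4 ·ₗ t) (designPieces t D))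

realiseDesign-isBaseBlock : ∀ v D m → All (Valid v) D → All (IsBaseBlock (⟦ v ⟧ m) (3 ∷ 5 ∷ [])) (realiseDesign D m)
realiseDesign-isBaseBlock v D m valid = All.concat⁺ (All.map⁺ (All.map (λ {s} → realise-isBaseBlock v s m) valid))

realiseDesign-diffs : ∀ v D m → All (Valid v) D → familyDiffs (⟦ v ⟧ m) (realiseDesign D m) ↭ ⟦ concatMap (pieces v) D ⟧ᵢₛ m
realiseDesign-diffs v []      m []              = ↭-refl
realiseDesign-diffs v (s ∷ D) m (valid ∷ valids) = begin
  familyDiffs V (realise s m ++ realiseDesign D m)
    ≡⟨ concatMap-++ (blockDiffs V) (realise s m) (realiseDesign D m) ⟩
  familyDiffs V (realise s m) ++ familyDiffs V (realiseDesign D m)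
    ↭⟨ ++⁺ (realise-diffs v s m valid) (realiseDesign-diffs v D m valids) ⟩
  ⟦ pieces v s ⟧ᵢₛ m ++ ⟦ concatMap (pieces v) D ⟧ᵢₛ m
    ≡⟨ concatMap-++ (λ i → ⟦ i ⟧ᵢ m) (pieces v s) (concatMap (pieces v) D) ⟨
  ⟦ concatMap (pieces v) (s ∷ D) ⟧ᵢₛ m
    ∎
  where
  open PermutationReasoning
  V = ⟦ v ⟧ m

⟦multiplesOf⟧ : ∀ t m → ⟦ multiplesOf t ⟧ᵢₛ m ≡ map (_* ⟦ t ⟧ m) (range 1 3)
⟦multiplesOf⟧ t m = begin
  ⟦ multiplesOf t ⟧ᵢₛ m                       ≡⟨ ⟦points⟧ (map (_·ₗ t) (range 1 3)) m ⟩
  map (λ x → ⟦ x ⟧ m) (map (_·ₗ t) (range 1 3)) ≡⟨ map-∘ {g = λ x → ⟦ x ⟧ m} {f = _·ₗ t} (range 1 3) ⟨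
  map (λ j → ⟦ j ·ₗ t ⟧ m) (range 1 3)          ≡⟨ map-cong (λ j → ⟦·ₗ⟧ j t m) (range 1 3) ⟩
  map (_* ⟦ t ⟧ m) (range 1 3)                  ∎
  where open ≡-Reasoning

cdf-fromDesign : ∀ t D → Certificate t D → ∀ m → IsCDF 4 (⟦ t ⟧ m) (3 ∷ 5 ∷ []) (realiseDesign D m)
cdf-fromDesign t D (valid , tiling) m with tiling-sound tiling m
... | L , total , tiles = isCDF-fromDifferences L (trans total v≡4t)
  (subst (λ V → All (IsBaseBlock V (3 ∷ 5 ∷ [])) F) v≡4t (realiseDesign-isBaseBlock v D m valid))
  (subst (λ V → familyDiffs V F ++ map (_* ⟦ t ⟧ m) (range 1 3) ↭ range 1 L) v≡4t (begin
    familyDiffs (⟦ v ⟧ m) F ++ map (_* ⟦ t ⟧ m) (range 1 3)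
      ↭⟨ ++⁺ (realiseDesign-diffs v D m valid) (↭-reflexive (sym (⟦multiplesOf⟧ t m))) ⟩
    ⟦ concatMap (pieces v) D ⟧ᵢₛ m ++ ⟦ multiplesOf t ⟧ᵢₛ m
      ≡⟨ concatMap-++ (λ i → ⟦ i ⟧ᵢ m) (concatMap (pieces v) D) (multiplesOf t) ⟨
    ⟦ designPieces t D ⟧ᵢₛ m
      ↭⟨ tiles ⟩
    range 1 L
      ∎))
  where
  open PermutationReasoning
  v = 4 ·ₗ t
  F = realiseDesign D m
  v≡4t : ⟦ v ⟧ m ≡ 4 * ⟦ t ⟧ m
  v≡4t = ⟦·ₗ⟧ 4 t m

-- The three residue classes

-- The first single triangle of design₃ and design₅ continues one family of the
-- twin by one block; it is listed separately because a twin has equal lengths.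
design₁ design₃ design₅ : List Shape
design₁ = twinTriangles (lin 1 0) (lin 9 8) (lin 4 4) (lin 2 2) ∷ []
design₃ =
  twinTriangles (lin 4 0) (lin 6 4) (lin 10 8) (lin 0 2) ∷
  block (triangle (lin 0 0) (lin 5 4) (lin 15 12)) ∷
  block (pentagon (lin 0 0) (lin 1 0) (lin 8 6) (lin 12 10) (lin 14 10)) ∷
  block (triangle (lin 0 0) (lin 3 0) (lin 19 12)) ∷ []
design₅ =
  twinTriangles (lin 4 0) (lin 14 4) (lin 25 8) (lin 1 2) ∷
  block (triangle (lin 0 0) (lin 6 4) (lin 20 8)) ∷
  block (pentagon (lin 0 0) (lin 1 0) (lin 8 4) (lin 11 4) (lin 44 16)) ∷
  block (triangle (lin 0 0) (lin 2 0) (lin 23 8)) ∷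
  block (pentagon (lin 0 0) (lin 9 4) (lin 22 8) (lin 38 14) (lin 50 18)) ∷ []

cdf₁ : ∀ m → IsCDF 4 (7 + 6 * m) (3 ∷ 5 ∷ []) (realiseDesign design₁ m)
cdf₁ = cdf-fromDesign (lin 7 6) design₁ (from-just (certify (lin 7 6) design₁))

cdf₃ : ∀ m → IsCDF 4 (9 + 6 * m) (3 ∷ 5 ∷ []) (realiseDesign design₃ m)
cdf₃ = cdf-fromDesign (lin 9 6) design₃ (from-just (certify (lin 9 6) design₃))

cdf₅ : ∀ m → IsCDF 4 (17 + 6 * m) (3 ∷ 5 ∷ []) (realiseDesign design₅ m)
cdf₅ = cdf-fromDesign (lin 17 6) design₅ (from-just (certify (lin 17 6) design₅))

OddResidue : ℕ → Set
OddResidue t = (∃ λ m → t ≡ 7 + 6 * m) ⊎ (∃ λ m → t ≡ 9 + 6 * m) ⊎ (∃ λ m → t ≡ 17 + 6 * m)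

2∣q*6 : ∀ q → 2 ∣ q * 6
2∣q*6 q = ∣-trans (divides 3 refl) (n∣m*n q)

r+[1+m]*6 : ∀ r m → r + suc m * 6 ≡ 6 + r + 6 * m
r+[1+m]*6 = solve-∀

oddResidue : ∀ t → ¬ 2 ∣ t → 7 ≤ t → t ≢ 11 → OddResidue t
oddResidue t odd 7≤t t≢11 with t % 6 | t / 6 | m≡m%n+[m/n]*n t 6 | m%n<n t 6
... | r | zero  | refl | r<6 = contradiction (≤-trans 7≤t (≤-reflexive (+-identityʳ r))) (<⇒≱ (m<n⇒m<1+n r<6))
... | 0 | suc q | refl | _   = contradiction (∣m∣n⇒∣m+n (divides 0 refl) (2∣q*6 (suc q))) odd
... | 2 | suc q | refl | _   = contradiction (∣m∣n⇒∣m+n (divides 1 refl) (2∣q*6 (suc q))) odd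
... | 4 | suc q | refl | _   = contradiction (∣m∣n⇒∣m+n (divides 2 refl) (2∣q*6 (suc q))) odd
... | 1 | suc m | refl | _   = inj₁ (m , r+[1+m]*6 1 m)
... | 3 | suc m | refl | _   = inj₂ (inj₁ (m , r+[1+m]*6 3 m))
... | 5 | 1     | refl | _   = contradiction refl t≢11
... | 5 | suc (suc m) | refl | _ = inj₂ (inj₂ (m , trans (r+[1+m]*6 5 (suc m)) (cong (11 +_) (*-suc 6 m))))
... | suc (suc (suc (suc (suc (suc _))))) | suc _ | refl | s≤s (s≤s (s≤s (s≤s (s≤s (s≤s ())))))

lemma4p15 : (t : ℕ) → ¬ (2 ∣ t) → 7 ≤ t → t ≢ 11 →
    ∃ λ (F : List (List ℕ)) → IsCDF 4 t (3 ∷ 5 ∷ []) F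
lemma4p15 t odd 7≤t t≢11 with oddResidue t odd 7≤t t≢11
... | inj₁ (m , refl)        = realiseDesign design₁ m , cdf₁ m
... | inj₂ (inj₁ (m , refl)) = realiseDesign design₃ m , cdf₃ m
... | inj₂ (inj₂ (m , refl)) = realiseDesign design₅ m , cdf₅ m
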